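{- Let $G=(U,V,E)$ be a bipartite graph with $|U|=|V|=N$ and let $l\geq 0$ be an integer. Suppose $G$ contains a perfect matching and that for every non-perfect matching $M\subseteq E$ there exists an augmenting path for $M$ of length at most $2l+1$. Run the simplified auction algorithm on $G$. Then for every iteration index $i$ and every vertex $u\in U$ that is free with respect to $M(i)$, there exists $j\in n_u$ with $h_j(i)\leq l$.
   Context: For a vertex $w$, $n_w$ denotes its set of neighbours. A vertex is free with respect to a matching $M$ if no edge of $M$ is incident to it. A matching $M$ is perfect if $|M|=N$. A path of length $l$ is a sequence of $l+1$ vertices $v_1,\dots,v_{l+1}$ with $\{v_k,v_{k+1}\}\in E$; it is alternating with respect to $M$ if $(v_k,v_{k+1})\notin M$ for odd $k$ and $\in M$ for even $k$; an augmenting path for $M$ is an alternating path from a free vertex of $U$ to a free vertex of $V$. The simplified auction algorithm maintains a matching $M\subseteq E$ and integer values $h_v$, $v\in V$: initially $M=\emptyset$, $h_v=0$. While $|M|<N$ and $\sum_{v\in V}h_v<N(N-1)$, it performs one iteration: choose (arbitrarily) a free vertex $u\in U$; choose $j\in\arg\min_{v\in n_u}h_v$ (ties arbitrary); if some $u_{old}$ has $(u_{old},j)\in M$, remove that edge; add $(u,j)$ to $M$; set $h_j\leftarrow h_j+1$. $M(i)$ and $h_v(i)$ denote the matching and values after $i$ iterations. -}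

module Defs where

open import Data.Nat using (ℕ; zero; suc; _+_; _*_; _∸_; _≤_; _<_)
open import Data.Fin using (Fin; inject₁) renaming (suc to fsuc)
open import Data.Fin.Properties using () renaming (_≟_ to _≟F_)
open import Data.List using (List; []; _∷_; length; map; filter; allFin)
open import Data.Nat.ListAction using (sum)
open import Data.List.Membership.Propositional using (_∈_; _∉_)
open import Data.List.Relation.Unary.All using (All)
open import Data.List.Relation.Unary.Unique.Propositional using (Unique)
open import Data.Product using (_×_; _,_; proj₁; proj₂; Σ; ∃)
open import Relation.Nullary using (¬_; ¬?; yes; no)
open import Relation.Binary.PropositionalEquality using (_≡_)

-- A bipartite graph G = (U, V, E) with U = V = Fin N is given by its
-- edge relation  E : Fin N → Fin N → Set ;  E u v  means {u,v} ∈ E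
-- with u ∈ U and v ∈ V.
Graph : ℕ → Set₁
Graph N = Fin N → Fin N → Set

EdgeList : ℕ → Set
EdgeList N = List (Fin N × Fin N)

-- M ⊆ E is a matching: every listed pair is an edge, and no vertex of U
-- (resp. V) occurs in two pairs (this also forbids duplicate pairs).
record IsMatching {N : ℕ} (E : Graph N) (M : EdgeList N) : Set where
  field
    subset  : All (λ e → E (proj₁ e) (proj₂ e)) M
    uniqueU : Unique (map proj₁ M)
    uniqueV : Unique (map proj₂ M)

card : {N : ℕ} → EdgeList N → ℕ
card M = length M

IsPerfect : {N : ℕ} → EdgeList N → Set
IsPerfect {N} M = card M ≡ N

FreeU : {N : ℕ} → EdgeList N → Fin N → Set
FreeU M u = u ∉ map proj₁ M

FreeV : {N : ℕ} → EdgeList N → Fin N → Set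
FreeV M v = v ∉ map proj₂ M

-- An alternating path of length 2k+1 with respect to M:
--   u₀, v₀, u₁, v₁, …, u_k, v_k
-- with edges {u_t, v_t} ∈ E \ M  (odd positions) and
-- {v_t, u_{t+1}} ∈ M  (even positions).  It is augmenting if u₀ ∈ U and
-- v_k ∈ V are free.  (An alternating path from U to V in a bipartite
-- graph necessarily has odd length.)
record AugmentingPath {N : ℕ} (E : Graph N) (M : EdgeList N) (k : ℕ) : Set where
  field
    us : Fin (suc k) → Fin N
    vs : Fin (suc k) → Fin N
    nonMatchingEdge : ∀ t → E (us t) (vs t) × (us t , vs t) ∉ M
    matchingEdge    : ∀ (t : Fin k) → (us (fsuc t) , vs (inject₁ t)) ∈ M
    startFree       : FreeU M (us Data.Fin.zero)
    endFree         : FreeV M (vs (Data.Fin.fromℕ k))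

pathLength : ℕ → ℕ
pathLength k = 2 * k + 1

record State (N : ℕ) : Set where
  constructor ⟨_,_⟩
  field
    matching : EdgeList N
    values   : Fin N → ℕ
open State public

initial : (N : ℕ) → State N
initial N = ⟨ [] , (λ _ → 0) ⟩

sumValues : {N : ℕ} → (Fin N → ℕ) → ℕ
sumValues {N} h = sum (map h (allFin N))

bump : {N : ℕ} → (Fin N → ℕ) → Fin N → (Fin N → ℕ)
bump h j v with v ≟F j
... | yes _ = suc (h v)
... | no  _ = h v

reassign : {N : ℕ} → EdgeList N → Fin N → Fin N → EdgeList N
reassign M u j = (u , j) ∷ filter (λ e → ¬? (proj₂ e ≟F j)) M

LoopCondition : {N : ℕ} → State N → Set
LoopCondition {N} s = card (matching s) < N × sumValues (values s) < N * (N ∸ 1)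

data Iteration {N : ℕ} (E : Graph N) (s : State N) : State N → Set where
  iter : (u j : Fin N) →
         FreeU (matching s) u →
         E u j →
         (∀ v → E u v → values s j ≤ values s v) →
         Iteration E s ⟨ reassign (matching s) u j , bump (values s) j ⟩

-- Reachable E i s : s = (M(i), h(i)) for some run of the algorithm
-- (with some sequence of arbitrary choices) that performs at least i iterations.
data Reachable {N : ℕ} (E : Graph N) : ℕ → State N → Set where
  start : Reachable E 0 (initial N)
  step  : ∀ {i s s'} → Reachable E i s → LoopCondition s →
          Iteration E s s' → Reachable E (suc i) s'

module Submission where

-- The prices satisfy ε-complementary slackness: unassigned objects cost 0, and an assigned
-- object costs at most one more than any other object its owner could bid on.  Given a free
-- bidder u, continue the auction for the other free bidders only (so prices never drop)
-- until u is the only free one; this terminates because, walking along a perfect matching,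
-- every price a bidder pays stays ≤ N.  The final matching is not perfect, so it has an
-- augmenting path of length 2k+1 ≤ 2l+1, which must start at u; slackness along the path
-- bounds the price of its first object by k plus the price of its free last object, i.e. by l.

open import Defs
open import Data.Nat using (ℕ; zero; suc; _+_; _*_; _∸_; _≤_; _<_; z≤n; s≤s)
open import Data.Nat.Properties
  using (≤-refl; ≤-trans; <-irrefl; ≤-pred; <⇒≤; n≤1+n; +-identityʳ; +-suc;
         +-mono-≤; +-mono-<-≤; +-mono-≤-<; ∸-monoʳ-≤; ∸-monoʳ-<; *-cancelˡ-≤; +-cancelʳ-≤;
         m<1+n⇒m<n∨m≡n; m<n⇒m<1+n; n<1+n; +-monoʳ-≤; <-≤-trans; m≤n+m; module ≤-Reasoning)
open import Data.Fin using (Fin; inject₁; fromℕ; toℕ; combine) renaming (zero to fzero; suc to fsuc)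
open import Data.Fin.Properties
  using (injective⇒≤; toℕ-injective; toℕ≤pred[n]; combine-injective; any?; all?; ¬∀⟶∃¬)
  renaming (_≟_ to _≟F_)
open import Data.List using (List; []; _∷_; length; map; filter; lookup; allFin)
open import Data.List.Properties using (length-map)
open import Data.Nat.ListAction using (sum)
open import Data.List.Membership.Propositional using (_∈_; _∉_)
open import Data.List.Membership.Propositional.Properties
  using (∈-map⁺; ∈-map⁻; ∈-filter⁺; ∈-filter⁻; ∈-lookup; ∈-allFin)
import Data.List.Membership.DecPropositional as DecMembership
open import Data.List.Relation.Unary.All using (All; []; _∷_)
import Data.List.Relation.Unary.All as All
import Data.List.Relation.Unary.All.Properties as All
open import Data.List.Relation.Unary.All.Properties.Core using (¬Any⇒All¬)
open import Data.List.Relation.Unary.Any using (here; there)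
import Data.List.Relation.Unary.AllPairs.Properties as AllPairs
open import Data.List.Relation.Unary.AllPairs using ([]; _∷_)
open import Data.List.Relation.Unary.Unique.Propositional using (Unique)
import Data.List.Relation.Unary.Unique.Propositional.Properties as Unique
open import Data.List.Extrema.Nat using (argmin; argmin-all; f[argmin]≤f[⊤]; f[argmin]≤f[xs])
open import Data.Product using (∃; _×_; _,_; proj₁; proj₂)
open import Data.Product.Properties using (≡-dec)
open import Data.Sum using (_⊎_; inj₁; inj₂)
open import Data.Empty using (⊥-elim)
open import Function using (_∘_)
open import Relation.Nullary using (¬_; ¬?; yes; no; Dec)
open import Relation.Nullary.Decidable using (_×-dec_; decidable-stable)
open import Relation.Unary using (Decidable)
open import Relation.Binary.PropositionalEquality using (_≡_; _≢_; refl; sym; trans; cong; subst)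

lookup-injective : ∀ {A : Set} {xs : List A} → Unique xs → ∀ {i j} → lookup xs i ≡ lookup xs j → i ≡ j
lookup-injective {xs = _ ∷ _} (_ ∷ _) {fzero} {fzero} _ = refl
lookup-injective (x∉xs ∷ _) {fzero} {fsuc j} eq = ⊥-elim (All.lookup x∉xs (∈-lookup j) eq)
lookup-injective (x∉xs ∷ _) {fsuc i} {fzero} eq = ⊥-elim (All.lookup x∉xs (∈-lookup i) (sym eq))
lookup-injective (_ ∷ xs!) {fsuc i} {fsuc j} eq = cong fsuc (lookup-injective xs! eq)

Unique⇒length≤ : ∀ {n} {xs : List (Fin n)} → Unique xs → length xs ≤ n
Unique⇒length≤ xs! = injective⇒≤ (lookup-injective xs!)

Unique-map⇒injectiveOn : ∀ {A B : Set} (f : A → B) {xs : List A} → Unique (map f xs) →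
                         ∀ {x y} → x ∈ xs → y ∈ xs → f x ≡ f y → x ≡ y
Unique-map⇒injectiveOn f _ (here refl) (here refl) _ = refl
Unique-map⇒injectiveOn f (fx∉ ∷ _) (here refl) (there y∈) eq = ⊥-elim (All.lookup fx∉ (∈-map⁺ f y∈) eq)
Unique-map⇒injectiveOn f (fy∉ ∷ _) (there x∈) (here refl) eq = ⊥-elim (All.lookup fy∉ (∈-map⁺ f x∈) (sym eq))
Unique-map⇒injectiveOn f (_ ∷ u) (there x∈) (there y∈) eq = Unique-map⇒injectiveOn f u x∈ y∈ eq

Unique-map-filter : ∀ {A B : Set} (f : A → B) {P : A → Set} (P? : Decidable P) {xs : List A} →
                    Unique (map f xs) → Unique (map f (filter P? xs))
Unique-map-filter f P? u = AllPairs.map⁺ (AllPairs.filter⁺ P? (AllPairs.map⁻ u))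

∈-map-filter⁻ : ∀ {A B : Set} (f : A → B) {P : A → Set} (P? : Decidable P) {xs : List A} {y} →
                y ∈ map f (filter P? xs) → ∃ λ x → x ∈ xs × P x × y ≡ f x
∈-map-filter⁻ f P? {xs} y∈ with ∈-map⁻ f y∈
... | x , x∈ , refl = x , proj₁ (∈-filter⁻ P? {xs = xs} x∈) , proj₂ (∈-filter⁻ P? {xs = xs} x∈) , refl

sum-map-mono : ∀ {A : Set} {f g : A → ℕ} → (∀ x → f x ≤ g x) → ∀ xs → sum (map f xs) ≤ sum (map g xs)
sum-map-mono f≤g [] = z≤n
sum-map-mono f≤g (x ∷ xs) = +-mono-≤ (f≤g x) (sum-map-mono f≤g xs)

sum-map-strictMono : ∀ {A : Set} {f g : A → ℕ} → (∀ x → f x ≤ g x) →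
                     ∀ {x xs} → x ∈ xs → f x < g x → sum (map f xs) < sum (map g xs)
sum-map-strictMono f≤g {xs = _ ∷ xs} (here refl) lt = +-mono-<-≤ lt (sum-map-mono f≤g xs)
sum-map-strictMono f≤g {xs = y ∷ _} (there x∈) lt = +-mono-≤-< (f≤g y) (sum-map-strictMono f≤g x∈ lt)

first-failure : ∀ {P : ℕ → Set} → (∀ s → Dec (P s)) → ∀ n →
                (∀ s → (∀ t → t < s → P t) → s < n) →
                ∃ λ s → (∀ t → t < s → P t) × ¬ P s
first-failure {P} P? n bounded = search n 0 ≤-refl (λ _ ())
  where
  search : ∀ d s → n ≤ s + d → (∀ t → t < s → P t) → ∃ λ s → (∀ t → t < s → P t) × ¬ P s
  search zero s n≤s prefix =
    ⊥-elim (<-irrefl refl (≤-trans (bounded s prefix) (subst (n ≤_) (+-identityʳ s) n≤s)))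
  search (suc d) s n≤ prefix with P? s
  ... | no ¬ps = s , prefix , ¬ps
  ... | yes ps = search d (suc s) (subst (n ≤_) (+-suc s d) n≤) prefix′
    where
    prefix′ : ∀ t → t < suc s → P t
    prefix′ t t<1+s with m<1+n⇒m<n∨m≡n t<1+s
    ... | inj₁ t<s = prefix t t<s
    ... | inj₂ refl = ps

bump-self : ∀ {N} (h : Fin N → ℕ) j → bump h j j ≡ suc (h j)
bump-self h j with j ≟F j
... | yes _ = refl
... | no j≢j = ⊥-elim (j≢j refl)

bump-other : ∀ {N} (h : Fin N → ℕ) {j v} → v ≢ j → bump h j v ≡ h v
bump-other h {j} {v} v≢j with v ≟F j
... | yes v≡j = ⊥-elim (v≢j v≡j)
... | no _ = refl

≤-bump : ∀ {N} (h : Fin N → ℕ) j v → h v ≤ bump h j v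
≤-bump h j v with v ≟F j
... | yes _ = n≤1+n (h v)
... | no _ = ≤-refl

module _ {N : ℕ} {M : EdgeList N} {u j : Fin N} where

  private
    keep? : Decidable (λ (e : Fin N × Fin N) → proj₂ e ≢ j)
    keep? e = ¬? (proj₂ e ≟F j)

  ∈-reassign⁻ : ∀ {e} → e ∈ reassign M u j → e ≡ (u , j) ⊎ (e ∈ M × proj₂ e ≢ j)
  ∈-reassign⁻ (here e≡uj) = inj₁ e≡uj
  ∈-reassign⁻ (there e∈) = inj₂ (∈-filter⁻ keep? {xs = M} e∈)

  reassign-FreeU : ∀ {x} → x ≢ u → FreeU M x → FreeU (reassign M u j) x
  reassign-FreeU x≢u _ (here x≡u) = x≢u x≡u
  reassign-FreeU x≢u x-free (there x∈) with ∈-map-filter⁻ proj₁ keep? {xs = M} x∈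
  ... | e , e∈M , _ , refl = x-free (∈-map⁺ proj₁ e∈M)

  reassign-FreeV⁻ : ∀ {v} → FreeV (reassign M u j) v → v ≢ j × FreeV M v
  reassign-FreeV⁻ {v} v-free = v≢j , λ v∈ → v-free (there (survives v∈))
    where
    v≢j : v ≢ j
    v≢j v≡j = v-free (here v≡j)
    survives : v ∈ map proj₂ M → v ∈ map proj₂ (filter keep? M)
    survives v∈ with ∈-map⁻ proj₂ v∈
    ... | e , e∈M , refl = ∈-map⁺ proj₂ (∈-filter⁺ keep? e∈M v≢j)

  reassign-IsMatching : ∀ {E : Graph N} → IsMatching E M → FreeU M u → E u j →
                        IsMatching E (reassign M u j)
  reassign-IsMatching isM u-free uj∈E = record
    { subset  = uj∈E ∷ All.filter⁺ keep? (IsMatching.subset isM)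
    ; uniqueU = ¬Any⇒All¬ _ u∉ ∷ Unique-map-filter proj₁ keep? (IsMatching.uniqueU isM)
    ; uniqueV = ¬Any⇒All¬ _ j∉ ∷ Unique-map-filter proj₂ keep? (IsMatching.uniqueV isM)
    }
    where
    u∉ : u ∉ map proj₁ (filter keep? M)
    u∉ u∈ with ∈-map-filter⁻ proj₁ keep? {xs = M} u∈
    ... | e , e∈M , _ , refl = u-free (∈-map⁺ proj₁ e∈M)
    j∉ : j ∉ map proj₂ (filter keep? M)
    j∉ j∈ with ∈-map-filter⁻ proj₂ keep? {xs = M} j∈
    ... | e , _ , e₂≢j , refl = e₂≢j refl

-- ε-complementary slackness (ε = 1) with respect to the relation Nb along which bids are placed.
record AuctionInvariant {N : ℕ} (E Nb : Graph N) (M : EdgeList N) (h : Fin N → ℕ) : Set where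
  field
    isMatching : IsMatching E M
    free⇒zero  : ∀ v → FreeV M v → h v ≡ 0
    slack      : ∀ {a b} → (a , b) ∈ M → ∀ {v} → Nb a v → h b ≤ suc (h v)
open AuctionInvariant

AuctionInvariant-step : ∀ {N} {E Nb : Graph N} {M h} → AuctionInvariant E Nb M h →
                        ∀ {u j} → FreeU M u → E u j → (∀ v → Nb u v → h j ≤ h v) →
                        AuctionInvariant E Nb (reassign M u j) (bump h j)
AuctionInvariant-step {Nb = Nb} {M} {h} I {u} {j} u-free uj∈E j-cheapest = record
  { isMatching = reassign-IsMatching (isMatching I) u-free uj∈E
  ; free⇒zero  = free⇒zero′
  ; slack      = slack′
  }
  where
  free⇒zero′ : ∀ v → FreeV (reassign M u j) v → bump h j v ≡ 0
  free⇒zero′ v v-free with reassign-FreeV⁻ {M = M} {u} v-free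
  ... | v≢j , v-free₀ = trans (bump-other h v≢j) (free⇒zero I v v-free₀)

  slack′ : ∀ {a b} → (a , b) ∈ reassign M u j → ∀ {v} → Nb a v → bump h j b ≤ suc (bump h j v)
  slack′ ab∈ {v} av with ∈-reassign⁻ {M = M} ab∈
  ... | inj₁ refl = subst (_≤ suc (bump h j v)) (sym (bump-self h j))
                          (s≤s (≤-trans (j-cheapest v av) (≤-bump h j v)))
  ... | inj₂ (ab∈M , b≢j) = subst (_≤ suc (bump h j v)) (sym (bump-other h b≢j))
                                  (≤-trans (slack I ab∈M av) (s≤s (≤-bump h j v)))

AuctionInvariant-restrict : ∀ {N} {E Nb Nb′ : Graph N} {M h} → (∀ {a v} → Nb′ a v → Nb a v) →
                            AuctionInvariant E Nb M h → AuctionInvariant E Nb′ M h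
AuctionInvariant-restrict Nb′⊆Nb I = record
  { isMatching = isMatching I
  ; free⇒zero  = free⇒zero I
  ; slack      = λ ab∈ av → slack I ab∈ (Nb′⊆Nb av)
  }

reachable⇒AuctionInvariant : ∀ {N} {E : Graph N} {i s} → Reachable E i s →
                             AuctionInvariant E E (matching s) (values s)
reachable⇒AuctionInvariant start = record
  { isMatching = record { subset = [] ; uniqueU = [] ; uniqueV = [] }
  ; free⇒zero  = λ _ _ → refl
  ; slack      = λ ()
  }
reachable⇒AuctionInvariant (step r _ (iter u j u-free uj∈E j-cheapest)) =
  AuctionInvariant-step (reachable⇒AuctionInvariant r) u-free uj∈E j-cheapest

FreeU⇒¬IsPerfect : ∀ {N} {M : EdgeList N} {u} → Unique (map proj₁ M) → FreeU M u → ¬ IsPerfect M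
FreeU⇒¬IsPerfect {N} {M} {u} M! u-free |M|≡N = <-irrefl refl
  (subst (λ n → suc n ≤ N) (trans (length-map proj₁ M) |M|≡N)
         (Unique⇒length≤ {xs = u ∷ map proj₁ M} (¬Any⇒All¬ _ u-free ∷ M!)))

descent-bound : ∀ k (g : Fin (suc k) → ℕ) → (∀ t → g (inject₁ t) ≤ suc (g (fsuc t))) →
                g fzero ≤ k + g (fromℕ k)
descent-bound zero g _ = ≤-refl
descent-bound (suc k) g descent = ≤-trans (descent fzero) (s≤s (descent-bound k (g ∘ fsuc) (descent ∘ fsuc)))

pathLength≤⇒≤ : ∀ {k l} → pathLength k ≤ 2 * l + 1 → k ≤ l
pathLength≤⇒≤ {k} {l} len = *-cancelˡ-≤ 2 (+-cancelʳ-≤ 1 (2 * k) (2 * l) len)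

module PerfectMatching {N} {E : Graph N} {Ms : EdgeList N}
                       (Ms-matching : IsMatching E Ms) (Ms-perfect : IsPerfect Ms) where

  open DecMembership (_≟F_ {N}) using (_∈?_)

  private
    covered : ∀ x → ∃ λ y → (x , y) ∈ Ms
    covered x with x ∈? map proj₁ Ms
    ... | no x-free = ⊥-elim (FreeU⇒¬IsPerfect (IsMatching.uniqueU Ms-matching) x-free Ms-perfect)
    ... | yes x∈ with ∈-map⁻ proj₁ x∈
    ...   | (_ , y) , xy∈ , refl = y , xy∈

  mate : Fin N → Fin N
  mate x = proj₁ (covered x)

  mate-∈ : ∀ x → (x , mate x) ∈ Ms
  mate-∈ x = proj₂ (covered x)

  mate-injective : ∀ {x y} → mate x ≡ mate y → x ≡ y
  mate-injective eq = cong proj₁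
    (Unique-map⇒injectiveOn proj₂ (IsMatching.uniqueV Ms-matching) (mate-∈ _) (mate-∈ _) eq)

-- Follow w, the owner of mate w, the owner of its mate, … : by injectivity of mate the walk
-- cannot revisit a vertex, so it reaches an unowned (hence zero-valued) mate within N steps,
-- and prices drop by at most one per step along it.
module MateWalk {N} {E Nb : Graph N}
                (mate : Fin N → Fin N) (mate-injective : ∀ {x y} → mate x ≡ mate y → x ≡ y)
                (mate-reachable : ∀ x → Nb x (mate x))
                {M : EdgeList N} {h : Fin N → ℕ} (I : AuctionInvariant E Nb M h)
                (w : Fin N) (w-free : FreeU M w) where

  open DecMembership (_≟F_ {N}) using (_∈?_)

  Taken : Fin N → Set
  Taken x = mate x ∈ map proj₂ M

  private
    owner : ∀ x → Taken x → ∃ λ y → (y , mate x) ∈ M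
    owner x taken with ∈-map⁻ proj₂ taken
    ... | (y , _) , ym∈ , refl = y , ym∈

  next : Fin N → Fin N
  next x with mate x ∈? map proj₂ M
  ... | yes taken = proj₁ (owner x taken)
  ... | no _ = x

  next-∈ : ∀ {x} → Taken x → (next x , mate x) ∈ M
  next-∈ {x} taken with mate x ∈? map proj₂ M
  ... | yes taken′ = proj₂ (owner x taken′)
  ... | no ¬taken = ⊥-elim (¬taken taken)

  next-injective : ∀ {x y} → Taken x → Taken y → next x ≡ next y → x ≡ y
  next-injective tx ty eq = mate-injective (cong proj₂
    (Unique-map⇒injectiveOn proj₁ (IsMatching.uniqueU (isMatching I)) (next-∈ tx) (next-∈ ty) eq))

  next≢w : ∀ {x} → Taken x → next x ≢ w
  next≢w taken eq = w-free (subst (_∈ map proj₁ M) eq (∈-map⁺ proj₁ (next-∈ taken)))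

  walk : ℕ → Fin N
  walk zero = w
  walk (suc s) = next (walk s)

  Unbroken : ℕ → Set
  Unbroken s = ∀ t → t < s → Taken (walk t)

  walk-value : ∀ s → Unbroken s → h (mate w) ≤ s + h (mate (walk s))
  walk-value zero _ = ≤-refl
  walk-value (suc s) unbroken = begin
    h (mate w)                          ≤⟨ walk-value s (λ t t<s → unbroken t (m<n⇒m<1+n t<s)) ⟩
    s + h (mate (walk s))               ≤⟨ +-monoʳ-≤ s (slack I (next-∈ (unbroken s (n<1+n s))) (mate-reachable _)) ⟩
    s + suc (h (mate (walk (suc s))))   ≡⟨ +-suc s _ ⟩
    suc s + h (mate (walk (suc s)))     ∎
    where open ≤-Reasoning

  walk-injective : ∀ {s} → Unbroken s → ∀ {a b} → a ≤ s → b ≤ s → walk a ≡ walk b → a ≡ b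
  walk-injective _        {zero}  {zero}  _   _   _  = refl
  walk-injective unbroken {zero}  {suc b} _   b<s eq = ⊥-elim (next≢w (unbroken b b<s) (sym eq))
  walk-injective unbroken {suc a} {zero}  a<s _   eq = ⊥-elim (next≢w (unbroken a a<s) eq)
  walk-injective unbroken {suc a} {suc b} a<s b<s eq = cong suc
    (walk-injective unbroken (<⇒≤ a<s) (<⇒≤ b<s) (next-injective (unbroken a a<s) (unbroken b b<s) eq))

  unbroken⇒< : ∀ s → Unbroken s → s < N
  unbroken⇒< s unbroken = injective⇒≤ {f = walk ∘ toℕ {suc s}}
    (λ eq → toℕ-injective (walk-injective unbroken (toℕ≤pred[n] _) (toℕ≤pred[n] _) eq))

  mate-value-bound : h (mate w) ≤ N
  mate-value-bound with first-failure (λ s → mate (walk s) ∈? map proj₂ M) N unbroken⇒<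
  ... | s , unbroken , ¬taken = begin
    h (mate w)             ≤⟨ walk-value s unbroken ⟩
    s + h (mate (walk s))  ≡⟨ cong (s +_) (free⇒zero I _ ¬taken) ⟩
    s + 0                  ≡⟨ +-identityʳ s ⟩
    s                      ≤⟨ <⇒≤ (unbroken⇒< s unbroken) ⟩
    N                      ∎
    where open ≤-Reasoning

module Completion {N} {E : Graph N} (l : ℕ)
  (short-augmenting : ∀ M → IsMatching E M → ¬ IsPerfect M →
                      ∃ λ k → AugmentingPath E M k × pathLength k ≤ 2 * l + 1)
  {Ms : EdgeList N} (Ms-matching : IsMatching E Ms) (Ms-perfect : IsPerfect Ms)
  (u : Fin N) {M₀ : EdgeList N} {h₀ : Fin N → ℕ}
  (I₀ : AuctionInvariant E E M₀ h₀) (u-free₀ : FreeU M₀ u) where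

  open PerfectMatching Ms-matching Ms-perfect
  open DecMembership (_≟F_ {N}) using (_∈?_)
  open DecMembership (≡-dec (_≟F_ {N}) (_≟F_ {N})) using () renaming (_∈?_ to _∈E?_)

  Adj : EdgeList N → Graph N
  Adj K a v = (a , v) ∈ K

  -- The continued auction bids along a finite subgraph containing a perfect matching, since
  -- no cheapest neighbour can be computed in the arbitrary relation E.  When the augmenting
  -- path found afterwards leaves the subgraph, its missing edge is added and we start over.
  record Subgraph : Set where
    field
      edges  : EdgeList N
      ⊆E     : All (λ e → E (proj₁ e) (proj₂ e)) edges
      unique : Unique edges
      mate∈  : ∀ x → (x , mate x) ∈ edges
  open Subgraph

  edges-length≤ : ∀ K → length (edges K) ≤ N * N
  edges-length≤ K = subst (_≤ N * N) (length-map code (edges K))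
                          (Unique⇒length≤ (Unique.map⁺ code-injective (unique K)))
    where
    code : Fin N × Fin N → Fin (N * N)
    code (a , v) = combine a v
    code-injective : ∀ {e e′} → code e ≡ code e′ → e ≡ e′
    code-injective {a , v} {a′ , v′} eq with combine-injective a v a′ v′ eq
    ... | refl , refl = refl

  grow : (K : Subgraph) → ∀ {a v} → E a v → (a , v) ∉ edges K → Subgraph
  grow K av∈E av∉K = record
    { edges  = _ ∷ edges K
    ; ⊆E     = av∈E ∷ ⊆E K
    ; unique = ¬Any⇒All¬ _ av∉K ∷ unique K
    ; mate∈  = there ∘ mate∈ K
    }

  neighbours : Subgraph → Fin N → List (Fin N)
  neighbours K w = filter (λ v → (w , v) ∈E? edges K) (allFin N)

  record Progress (K : Subgraph) (M : EdgeList N) (h : Fin N → ℕ) : Set where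
    field
      invariant : AuctionInvariant E (Adj (edges K)) M h
      u-free    : FreeU M u
      h₀≤h      : ∀ v → h₀ v ≤ h v
  open Progress

  record Completed (K : Subgraph) : Set where
    field
      M           : EdgeList N
      h           : Fin N → ℕ
      progress    : Progress K M h
      only-u-free : ∀ w → w ≢ u → w ∈ map proj₁ M

  headroom : (Fin N → ℕ) → ℕ
  headroom h = sum (map (λ v → suc N ∸ h v) (allFin N))

  -- The cheapest neighbour costs at most the mate, hence at most N, so raising it lowers the headroom.
  bid : ∀ {K M h} → Progress K M h → ∀ w → w ≢ u → FreeU M w →
        ∃ λ j → Progress K (reassign M w j) (bump h j) × headroom (bump h j) < headroom h
  bid {K} {M} {h} P w w≢u w-free = j , P′ , headroom-drops
    where
    j : Fin N
    j = argmin h (mate w) (neighbours K w)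

    j-adjacent : (w , j) ∈ edges K
    j-adjacent = argmin-all h (mate∈ K w)
      (All.tabulate (λ v∈ → proj₂ (∈-filter⁻ (λ v → (w , v) ∈E? edges K) {xs = allFin N} v∈)))

    j-cheapest : ∀ v → Adj (edges K) w v → h j ≤ h v
    j-cheapest v wv = All.lookup (f[argmin]≤f[xs] {f = h} (mate w) (neighbours K w))
                                 (∈-filter⁺ (λ v → (w , v) ∈E? edges K) (∈-allFin v) wv)

    j-bounded : h j ≤ N
    j-bounded = ≤-trans (f[argmin]≤f[⊤] {f = h} (mate w) (neighbours K w))
      (MateWalk.mate-value-bound mate mate-injective (mate∈ K) (invariant P) w w-free)

    P′ : Progress K (reassign M w j) (bump h j)
    P′ = record
      { invariant = AuctionInvariant-step (invariant P) w-free (All.lookup (⊆E K) j-adjacent) j-cheapest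
      ; u-free    = reassign-FreeU (w≢u ∘ sym) (u-free P)
      ; h₀≤h      = λ v → ≤-trans (h₀≤h P v) (≤-bump h j v)
      }

    headroom-drops : headroom (bump h j) < headroom h
    headroom-drops = sum-map-strictMono (λ v → ∸-monoʳ-≤ (suc N) (≤-bump h j v)) (∈-allFin j)
      (subst (λ x → suc N ∸ x < suc N ∸ h j) (sym (bump-self h j))
             (∸-monoʳ-< {suc N} {suc (h j)} {h j} ≤-refl (s≤s j-bounded)))

  complete : ∀ K fuel {M h} → Progress K M h → headroom h < fuel → Completed K
  complete K zero _ ()
  complete K (suc fuel) {M} {h} P h<fuel with any? (λ w → ¬? (w ≟F u) ×-dec ¬? (w ∈? map proj₁ M))
  ... | no no-other-free = record
    { M = M ; h = h ; progress = P
    ; only-u-free = λ w w≢u → decidable-stable (w ∈? map proj₁ M) (λ w-free → no-other-free (w , w≢u , w-free))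
    }
  ... | yes (w , w≢u , w-free) with bid P w w≢u w-free
  ...   | _ , P′ , drop = complete K fuel P′ (<-≤-trans drop (≤-pred h<fuel))

  completed : ∀ K → Completed K
  completed K = complete K (suc (headroom h₀)) P₀ ≤-refl
    where
    P₀ : Progress K M₀ h₀
    P₀ = record
      { invariant = AuctionInvariant-restrict (All.lookup (⊆E K)) I₀
      ; u-free    = u-free₀
      ; h₀≤h      = λ _ → ≤-refl
      }

  Conclusion : Set
  Conclusion = ∃ λ j → E u j × h₀ j ≤ l

  path-inside⇒conclusion : ∀ {K} (C : Completed K) → let open Completed C in
    ∀ {k} (p : AugmentingPath E M k) → k ≤ l →
    (∀ t → Adj (edges K) (AugmentingPath.us p (fsuc t)) (AugmentingPath.vs p (fsuc t))) →
    Conclusion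
  path-inside⇒conclusion C {k} p k≤l inside =
    vs fzero , subst (λ x → E x (vs fzero)) starts-at-u (proj₁ (nonMatchingEdge fzero)) , price-bound
    where
    open Completed C
    open AugmentingPath p
    I = invariant progress

    starts-at-u : us fzero ≡ u
    starts-at-u with us fzero ≟F u
    ... | yes eq = eq
    ... | no us₀≢u = ⊥-elim (startFree (only-u-free _ us₀≢u))

    price-bound : h₀ (vs fzero) ≤ l
    price-bound = begin
      h₀ (vs fzero)          ≤⟨ h₀≤h progress (vs fzero) ⟩
      h (vs fzero)           ≤⟨ descent-bound k (h ∘ vs) (λ t → slack I (matchingEdge t) (inside t)) ⟩
      k + h (vs (fromℕ k))   ≡⟨ cong (k +_) (free⇒zero I _ endFree) ⟩
      k + 0                  ≡⟨ +-identityʳ k ⟩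
      k                      ≤⟨ k≤l ⟩
      l                      ∎
      where open ≤-Reasoning

  inside? : ∀ K {M k} (p : AugmentingPath E M k) (t : Fin k) →
            Dec (Adj (edges K) (AugmentingPath.us p (fsuc t)) (AugmentingPath.vs p (fsuc t)))
  inside? K p t = (AugmentingPath.us p (fsuc t) , AugmentingPath.vs p (fsuc t)) ∈E? edges K

  NewEdge : Subgraph → Set
  NewEdge K = ∃ λ e → E (proj₁ e) (proj₂ e) × e ∉ edges K

  conclusion-or-new-edge : ∀ K → Conclusion ⊎ NewEdge K
  conclusion-or-new-edge K = from-path (short-augmenting M (isMatching I) M-not-perfect)
    where
    C : Completed K
    C = completed K
    open Completed C
    I = invariant progress

    M-not-perfect : ¬ IsPerfect M
    M-not-perfect = FreeU⇒¬IsPerfect (IsMatching.uniqueU (isMatching I)) (u-free progress)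

    from-path : (∃ λ k → AugmentingPath E M k × pathLength k ≤ 2 * l + 1) → Conclusion ⊎ NewEdge K
    from-path (k , p , len) with all? (inside? K p)
    ... | yes inside = inj₁ (path-inside⇒conclusion C p (pathLength≤⇒≤ len) inside)
    ... | no ¬inside with ¬∀⟶∃¬ _ _ (inside? K p) ¬inside
    ...   | t , outside = inj₂ (_ , proj₁ (AugmentingPath.nonMatchingEdge p (fsuc t)) , outside)

  search : ∀ d K → N * N ≤ length (edges K) + d → Conclusion
  search d K bound with conclusion-or-new-edge K
  ... | inj₁ done = done
  ... | inj₂ (_ , e∈E , e∉K) with d
  ...   | zero = ⊥-elim (<-irrefl refl
            (≤-trans (edges-length≤ (grow K e∈E e∉K)) (subst (N * N ≤_) (+-identityʳ _) bound)))
  ...   | suc d′ = search d′ (grow K e∈E e∉K) (subst (N * N ≤_) (+-suc _ d′) bound)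

  conclusion : Conclusion
  conclusion = search (N * N) K₀ (m≤n+m (N * N) (length Ms))
    where
    K₀ : Subgraph
    K₀ = record
      { edges  = Ms
      ; ⊆E     = IsMatching.subset Ms-matching
      ; unique = Unique.map⁻ (IsMatching.uniqueU Ms-matching)
      ; mate∈  = mate-∈
      }

mainTheorem6 : (N : ℕ) (E : Graph N) (l : ℕ) →
    (∃ λ M → IsMatching E M × IsPerfect M) →
    (∀ M → IsMatching E M → ¬ IsPerfect M →
       ∃ λ k → AugmentingPath E M k × pathLength k ≤ 2 * l + 1) →
    ∀ (i : ℕ) (s : State N) → Reachable E i s →
    ∀ u → FreeU (matching s) u →
    ∃ λ j → E u j × values s j ≤ l
mainTheorem6 N E l (Ms , Ms-matching , Ms-perfect) short-augmenting i s reachable u u-free =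
  Completion.conclusion l short-augmenting Ms-matching Ms-perfect u
    (reachable⇒AuctionInvariant reachable) u-free
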